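{- For any $n\geq1$, $C_{q_n-1}(s_n)=w_{n-1}v_{n-2}$ and $C_{q_{n-1}-1}(s_n)=v_{n-2}w_{n-1}$. Moreover: (1) for $0\le k\le q_{n-1}-2$, $C_k(s_n)=uv_{n-2}v$, where $u,v$ are the words with $vu=w_{n-1}$ and $|v|=k+1$; (2) for $q_{n-1}-1\le k\le q_n-1$, $C_k(s_n)=uw_{n-1}v$, where $u,v$ are the words with $vu=v_{n-2}$ and $|v|=k+1-q_{n-1}$.
   Context: Words over $\{a,b\}$; $\varepsilon$ empty word; $x^{ -1}$ inverse in the free group (used only where results are words). For a word $w=x_1\cdots x_m$ and $0\le k\le m-1$, the $k$-th conjugate is $C_k(w)=x_{k+1}\cdots x_mx_1\cdots x_k$. Standing assumption: $\alpha=[0;1+d_1,d_2,d_3,\ldots]$ irrational, all integers $d_i\ge1$. $s_{ -1}=b$, $s_0=a$, $s_n=s_{n-1}^{d_n}s_{n-2}$ ($n\ge1$); $q_n=|s_n|$ for $n\ge0$, $q_{ -1}=1$. $w_{ -1}=a$, for $n\ge0$: $w_n=as_nb^{ -1}$ ($n$ odd), $w_n=bs_na^{ -1}$ ($n$ even). $v_{ -2}=\varepsilon$, for $n\ge-1$: $v_n=as_{n+1}^{d_{n+2}-1}s_nb^{ -1}$ ($n$ odd), $v_n=bs_{n+1}^{d_{n+2}-1}s_na^{ -1}$ ($n$ even). -}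

module Defs where

open import Data.Nat using (ℕ; zero; suc; _∸_)
open import Data.Bool using (Bool; true; false; if_then_else_; not; _∧_; _xor_)
open import Data.Product using (_×_; _,_)
open import Data.List using (List; []; _∷_; _++_; map; foldr; drop; take; length)

data Letter : Set where
  a b : Letter

Word : Set
Word = List Letter

-- Free group on {a,b}: elements are reduced words over generators
-- (letter , true) = letter, (letter , false) = its inverse.
Gen : Set
Gen = Letter × Bool

FWord : Set
FWord = List Gen

sameLetter : Letter → Letter → Bool
sameLetter a a = true
sameLetter b b = true
sameLetter a b = false
sameLetter b a = false

cancels : Gen → Gen → Bool
cancels (x , s) (y , t) = sameLetter x y ∧ (s xor t)

push : Gen → FWord → FWord
push g [] = g ∷ []
push g (h ∷ r) = if cancels g h then r else g ∷ h ∷ r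

infixl 6 _·_
_·_ : FWord → FWord → FWord
u · v = foldr push v u

ι : Word → FWord
ι = map (λ x → (x , true))

inv : Letter → FWord
inv x = (x , false) ∷ []

pow : Word → ℕ → Word
pow w zero = []
pow w (suc k) = w ++ pow w k

C : ℕ → Word → Word
C k w = drop k w ++ take k w

even : ℕ → Bool
even zero = true
even (suc n) = not (even n)

-- The sequences depend on d : ℕ → ℕ, where d i = d_i for i ≥ 1 (d 0 unused).
-- Shifted indexing:  S j = s_{j-1}  (so S 0 = s_{-1} = b, S 1 = s_0 = a).
S : (ℕ → ℕ) → ℕ → Word
S d zero = b ∷ []
S d (suc zero) = a ∷ []
S d (suc (suc m)) = pow (S d (suc m)) (d (suc m)) ++ S d m
-- i.e. s_{m+1} = s_m^{d_{m+1}} s_{m-1}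

-- q_n = |s_n| for n ≥ 0, q_{-1} = 1 = |s_{-1}|;  Q j = q_{j-1}
Q : (ℕ → ℕ) → ℕ → ℕ
Q d j = length (S d j)

-- W j = w_{j-1}:  w_{-1} = a;  w_n = a s_n b⁻¹ (n odd), b s_n a⁻¹ (n even)
W : (ℕ → ℕ) → ℕ → FWord
W d zero = ι (a ∷ [])
W d (suc n) =
  if even n
  then ι (b ∷ []) · ι (S d (suc n)) · inv a
  else ι (a ∷ []) · ι (S d (suc n)) · inv b

-- V j = v_{j-2}:  v_{-2} = ε;  for t ≥ 0, V (suc t) = v_{t-1} where
-- v_{t-1} = a s_t^{d_{t+1}-1} s_{t-1} b⁻¹ (t-1 odd, i.e. t even),
--           b s_t^{d_{t+1}-1} s_{t-1} a⁻¹ (t-1 even, i.e. t odd)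
V : (ℕ → ℕ) → ℕ → FWord
V d zero = []
V d (suc t) =
  if even t
  then ι (a ∷ []) · ι (pow (S d (suc t)) (d (suc t) ∸ 1)) · ι (S d t) · inv b
  else ι (b ∷ []) · ι (pow (S d (suc t)) (d (suc t) ∸ 1)) · ι (S d t) · inv a

module Submission where

-- Write s_{n-1} = x c' and
-- s_{n-2} = y c, where c' and c are the last letters, and let
-- P = s_{n-1}^{d_n - 1}.  Since s_n = s_{n-1} P s_{n-2} (as d_n ≥ 1),
--
--     s_n = x · v · c   with   v = c' P y,
--
-- and in the free group the defining products cancel down to positive
-- words:  w_{n-1} = c x  and  v_{n-2} = v  (the last letters of s_m
-- alternate with the parity of m, which is exactly what makes the trailing
-- inverse letter in w and v cancel).

open import Defs
open import Data.Nat using (ℕ; suc; _+_; _∸_; _≤_)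
open import Data.Product using (_×_; Σ-syntax)
open import Data.List using (_++_; length)
open import Relation.Binary.PropositionalEquality using (_≡_)

open import Data.Nat using (zero; z≤n; s≤s)
open import Data.Nat.Properties
  using (≤-pred; <⇒≤; +-comm; +-assoc; +-identityʳ; +-cancelˡ-≤; +-cancelʳ-≤;
         m+n∸m≡n; m≤n⇒∃[o]m+o≡n)
open import Data.Bool using (true; false; not)
open import Data.Product using (_,_)
open import Data.Sum using (_⊎_; inj₁; inj₂)
open import Data.List using ([]; _∷_; take; drop)
open import Data.List.Properties using (++-assoc; ++-identityʳ; take++drop≡id; length-++)
open import Relation.Binary.PropositionalEquality using (refl; sym; trans; cong; cong₂; subst)
open Relation.Binary.PropositionalEquality.≡-Reasoning

push-positive : ∀ x w → push (x , true) (ι w) ≡ ι (x ∷ w)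
push-positive x []      = refl
push-positive a (a ∷ w) = refl
push-positive a (b ∷ w) = refl
push-positive b (a ∷ w) = refl
push-positive b (b ∷ w) = refl

ι-++ : ∀ p q → ι p · ι q ≡ ι (p ++ q)
ι-++ []      q = refl
ι-++ (x ∷ p) q = trans (cong (push (x , true)) (ι-++ p q)) (push-positive x (p ++ q))

ι-cancel-last : ∀ p ℓ → ι (p ++ ℓ ∷ []) · inv ℓ ≡ ι p
ι-cancel-last []      a = refl
ι-cancel-last []      b = refl
ι-cancel-last (x ∷ p) ℓ =
  trans (cong (push (x , true)) (ι-cancel-last p ℓ)) (push-positive x p)

ι-wrap : ∀ p y ℓ → ι p · ι (y ++ ℓ ∷ []) · inv ℓ ≡ ι (p ++ y)
ι-wrap p y ℓ = begin
  ι p · ι (y ++ ℓ ∷ []) · inv ℓ  ≡⟨ cong (_· inv ℓ) (ι-++ p (y ++ ℓ ∷ [])) ⟩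
  ι (p ++ y ++ ℓ ∷ []) · inv ℓ   ≡⟨ cong (λ z → ι z · inv ℓ) (sym (++-assoc p y (ℓ ∷ []))) ⟩
  ι ((p ++ y) ++ ℓ ∷ []) · inv ℓ ≡⟨ ι-cancel-last (p ++ y) ℓ ⟩
  ι (p ++ y)                     ∎

ι-wrap-prefixed : ∀ c P y ℓ → ι (c ∷ []) · ι P · ι (y ++ ℓ ∷ []) · inv ℓ ≡ ι (c ∷ P ++ y)
ι-wrap-prefixed c P y ℓ =
  trans (cong (λ z → z · ι (y ++ ℓ ∷ []) · inv ℓ) (ι-++ (c ∷ []) P)) (ι-wrap (c ∷ P) y ℓ)

ι-++₃ : ∀ p q r → ι p · ι q · ι r ≡ ι (p ++ q ++ r)
ι-++₃ p q r = begin
  ι p · ι q · ι r    ≡⟨ cong (_· ι r) (ι-++ p q) ⟩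
  ι (p ++ q) · ι r   ≡⟨ ι-++ (p ++ q) r ⟩
  ι ((p ++ q) ++ r)  ≡⟨ cong ι (++-assoc p q r) ⟩
  ι (p ++ q ++ r)    ∎

drop-++-inside : ∀ k (p q : Word) → k ≤ length p → drop k (p ++ q) ≡ drop k p ++ q
drop-++-inside zero    p       q _       = refl
drop-++-inside (suc k) (x ∷ p) q (s≤s h) = drop-++-inside k p q h

take-++-inside : ∀ k (p q : Word) → k ≤ length p → take k (p ++ q) ≡ take k p
take-++-inside zero    p       q _       = refl
take-++-inside (suc k) (x ∷ p) q (s≤s h) = cong (x ∷_) (take-++-inside k p q h)

drop-++-past : ∀ j (p q : Word) → drop (length p + j) (p ++ q) ≡ drop j q
drop-++-past j []      q = refl
drop-++-past j (x ∷ p) q = drop-++-past j p q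

take-++-past : ∀ j (p q : Word) → take (length p + j) (p ++ q) ≡ p ++ take j q
take-++-past j []      q = refl
take-++-past j (x ∷ p) q = cong (x ∷_) (take-++-past j p q)

length-take-≤ : ∀ k (p : Word) → k ≤ length p → length (take k p) ≡ k
length-take-≤ zero    p       _       = refl
length-take-≤ (suc k) (x ∷ p) (s≤s h) = cong suc (length-take-≤ k p h)

C-inside : ∀ k (p q : Word) → k ≤ length p → C k (p ++ q) ≡ drop k p ++ q ++ take k p
C-inside k p q h = begin
  drop k (p ++ q) ++ take k (p ++ q)
    ≡⟨ cong₂ _++_ (drop-++-inside k p q h) (take-++-inside k p q h) ⟩
  (drop k p ++ q) ++ take k p
    ≡⟨ ++-assoc (drop k p) q (take k p) ⟩
  drop k p ++ q ++ take k p ∎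

C-past : ∀ j (p q : Word) → C (length p + j) (p ++ q) ≡ drop j q ++ p ++ take j q
C-past j p q = cong₂ _++_ (drop-++-past j p q) (take-++-past j p q)

C-length : ∀ (p q : Word) → C (length p) (p ++ q) ≡ q ++ p
C-length p q = begin
  C (length p) (p ++ q)     ≡⟨ cong (λ k → C k (p ++ q)) (sym (+-identityʳ (length p))) ⟩
  C (length p + 0) (p ++ q) ≡⟨ C-past 0 p q ⟩
  q ++ p ++ []              ≡⟨ cong (q ++_) (++-identityʳ p) ⟩
  q ++ p                    ∎

k+2≤1+n⇒k≤n : ∀ k n → k + 2 ≤ suc n → k ≤ n
k+2≤1+n⇒k≤n k n h = <⇒≤ (≤-pred (subst (_≤ suc n) (+-comm k 2) h))

1+m≤k+1⇒m≤k : ∀ m k → suc m ≤ k + 1 → m ≤ k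
1+m≤k+1⇒m≤k m k h = ≤-pred (subst (suc m ≤_) (+-comm k 1) h)

m+j+1≤m+[l+1]⇒j≤l : ∀ m j l → m + j + 1 ≤ m + (l + 1) → j ≤ l
m+j+1≤m+[l+1]⇒j≤l m j l h =
  +-cancelʳ-≤ 1 j l (+-cancelˡ-≤ m (j + 1) (l + 1) (subst (_≤ m + (l + 1)) (+-assoc m j 1) h))

m+j+1∸[1+m]≡j : ∀ m j → m + j + 1 ∸ suc m ≡ j
m+j+1∸[1+m]≡j m j = trans (cong (_∸ suc m) (+-comm (m + j) 1)) (m+n∸m≡n m j)

-- The conclusion of the lemma for a word s, with w and v given as free-group
-- elements and q the rotation offset (q = |w| in the intended use).
ConjugateShape : Word → FWord → FWord → ℕ → Set
ConjugateShape s w v q =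
    (ι (C (length s ∸ 1) s) ≡ w · v)
    × (ι (C (q ∸ 1) s) ≡ v · w)
    × (∀ k → k + 2 ≤ q →
         Σ[ u ∈ Word ] Σ[ t ∈ Word ]
           (ι (t ++ u) ≡ w) × (length t ≡ k + 1)
           × (ι (C k s) ≡ ι u · v · ι t))
    × (∀ k → q ≤ k + 1 → k + 1 ≤ length s →
         Σ[ u ∈ Word ] Σ[ t ∈ Word ]
           (ι (t ++ u) ≡ v) × (length t ≡ k + 1 ∸ q)
           × (ι (C k s) ≡ ι u · w · ι t))

-- The rotations of a word  x v c  relative to its factors  w = c x  and  v.
module Rotations (x v : Word) (c : Letter) where

  s : Word
  s = x ++ v ++ c ∷ []

  length-s : length s ≡ length x + (length v + 1)
  length-s = trans (length-++ x) (cong (length x +_) (length-++ v))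

  rotate-last : ι (C (length s ∸ 1) s) ≡ ι (c ∷ x) · ι v
  rotate-last = begin
    ι (C (length s ∸ 1) s)           ≡⟨ cong (λ k → ι (C k s)) last-position ⟩
    ι (C (length (x ++ v)) s)        ≡⟨ cong (λ z → ι (C (length (x ++ v)) z)) s-assoc ⟩
    ι (C (length (x ++ v)) ((x ++ v) ++ c ∷ []))
                                     ≡⟨ cong ι (C-length (x ++ v) (c ∷ [])) ⟩
    ι (c ∷ x ++ v)                   ≡⟨ sym (ι-++ (c ∷ x) v) ⟩
    ι (c ∷ x) · ι v                  ∎
    where
    s-assoc : s ≡ (x ++ v) ++ c ∷ []
    s-assoc = sym (++-assoc x v (c ∷ []))
    last-position : length s ∸ 1 ≡ length (x ++ v)
    last-position = begin
      length s ∸ 1                    ≡⟨ cong (λ z → length z ∸ 1) s-assoc ⟩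
      length ((x ++ v) ++ c ∷ []) ∸ 1 ≡⟨ cong (_∸ 1) (length-++ (x ++ v)) ⟩
      length (x ++ v) + 1 ∸ 1         ≡⟨ cong (_∸ 1) (+-comm (length (x ++ v)) 1) ⟩
      length (x ++ v)                 ∎

  rotate-first : ι (C (suc (length x) ∸ 1) s) ≡ ι v · ι (c ∷ x)
  rotate-first = begin
    ι (C (length x) s)     ≡⟨ cong ι (C-length x (v ++ c ∷ [])) ⟩
    ι ((v ++ c ∷ []) ++ x) ≡⟨ cong ι (++-assoc v (c ∷ []) x) ⟩
    ι (v ++ c ∷ x)         ≡⟨ sym (ι-++ v (c ∷ x)) ⟩
    ι v · ι (c ∷ x)        ∎

  rotate-inside-w : ∀ k → k ≤ length x →
    ι (C k s) ≡ ι (drop k x) · ι v · ι (c ∷ take k x)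
  rotate-inside-w k h = begin
    ι (C k s)                                 ≡⟨ cong ι (C-inside k x (v ++ c ∷ []) h) ⟩
    ι (drop k x ++ (v ++ c ∷ []) ++ take k x) ≡⟨ cong (λ z → ι (drop k x ++ z)) (++-assoc v (c ∷ []) (take k x)) ⟩
    ι (drop k x ++ v ++ c ∷ take k x)         ≡⟨ sym (ι-++₃ (drop k x) v (c ∷ take k x)) ⟩
    ι (drop k x) · ι v · ι (c ∷ take k x)     ∎

  rotate-inside-v : ∀ j → j ≤ length v →
    ι (C (length x + j) s) ≡ ι (drop j v) · ι (c ∷ x) · ι (take j v)
  rotate-inside-v j h = begin
    ι (C (length x + j) s)                          ≡⟨ cong ι (C-past j x (v ++ c ∷ [])) ⟩
    ι (drop j (v ++ c ∷ []) ++ x ++ take j (v ++ c ∷ []))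
      ≡⟨ cong₂ (λ p q → ι (p ++ x ++ q)) (drop-++-inside j v (c ∷ []) h) (take-++-inside j v (c ∷ []) h) ⟩
    ι ((drop j v ++ c ∷ []) ++ x ++ take j v)       ≡⟨ cong ι (++-assoc (drop j v) (c ∷ []) (x ++ take j v)) ⟩
    ι (drop j v ++ c ∷ x ++ take j v)               ≡⟨ sym (ι-++₃ (drop j v) (c ∷ x) (take j v)) ⟩
    ι (drop j v) · ι (c ∷ x) · ι (take j v)         ∎

  rotations : ConjugateShape s (ι (c ∷ x)) (ι v) (suc (length x))
  rotations = rotate-last , rotate-first , cut-in-w , cut-in-v
    where
    cut-in-w : ∀ k → k + 2 ≤ suc (length x) →
      Σ[ u ∈ Word ] Σ[ t ∈ Word ]
        (ι (t ++ u) ≡ ι (c ∷ x)) × (length t ≡ k + 1)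
        × (ι (C k s) ≡ ι u · ι v · ι t)
    cut-in-w k h =
      drop k x , c ∷ take k x ,
      cong (λ z → ι (c ∷ z)) (take++drop≡id k x) ,
      trans (cong suc (length-take-≤ k x k≤x)) (+-comm 1 k) ,
      rotate-inside-w k k≤x
      where
      k≤x : k ≤ length x
      k≤x = k+2≤1+n⇒k≤n k (length x) h

    cut-in-v : ∀ k → suc (length x) ≤ k + 1 → k + 1 ≤ length s →
      Σ[ u ∈ Word ] Σ[ t ∈ Word ]
        (ι (t ++ u) ≡ ι v) × (length t ≡ k + 1 ∸ suc (length x))
        × (ι (C k s) ≡ ι u · ι (c ∷ x) · ι t)
    cut-in-v k h₁ h₂ with m≤n⇒∃[o]m+o≡n (1+m≤k+1⇒m≤k (length x) k h₁)
    ... | j , refl =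
      drop j v , take j v ,
      cong ι (take++drop≡id j v) ,
      trans (length-take-≤ j v j≤v) (sym (m+j+1∸[1+m]≡j (length x) j)) ,
      rotate-inside-v j j≤v
      where
      j≤v : j ≤ length v
      j≤v = m+j+1≤m+[l+1]⇒j≤l (length x) j (length v) (subst (length x + j + 1 ≤_) length-s h₂)

ConjugateShape-transport : ∀ {s s′ w w′ v v′ q q′} →
  s′ ≡ s → w′ ≡ w → v′ ≡ v → q′ ≡ q →
  ConjugateShape s w v q → ConjugateShape s′ w′ v′ q′
ConjugateShape-transport refl refl refl refl shape = shape

lastLetter : ℕ → Letter
lastLetter zero          = b
lastLetter (suc zero)    = a
lastLetter (suc (suc j)) = lastLetter j

lastLetter-parity : ∀ m →
    (even m ≡ true  × lastLetter m ≡ b × lastLetter (suc m) ≡ a)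
  ⊎ (even m ≡ false × lastLetter m ≡ a × lastLetter (suc m) ≡ b)
lastLetter-parity zero = inj₁ (refl , refl , refl)
lastLetter-parity (suc m) with lastLetter-parity m
... | inj₁ (ev , ℓm , ℓ1+m) = inj₂ (cong not ev , ℓ1+m , ℓm)
... | inj₂ (ev , ℓm , ℓ1+m) = inj₁ (cong not ev , ℓ1+m , ℓm)

pow-unfold : ∀ (w : Word) k → 1 ≤ k → pow w k ≡ w ++ pow w (k ∸ 1)
pow-unfold w (suc k) _ = refl

regroup : ∀ (x : Word) c′ P y c →
  ((x ++ c′ ∷ []) ++ P) ++ (y ++ c ∷ []) ≡ x ++ (c′ ∷ P ++ y) ++ c ∷ []
regroup []      c′ P y c = cong (c′ ∷_) (sym (++-assoc P y (c ∷ [])))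
regroup (z ∷ x) c′ P y c = cong (z ∷_) (regroup x c′ P y c)

module StandardWords (d : ℕ → ℕ) where

  -- Every s_j ends with lastLetter j (as s_{j+1} ends with s_{j-1}).
  ends-with : ∀ j → Σ[ x ∈ Word ] (S d j ≡ x ++ lastLetter j ∷ [])
  ends-with zero          = [] , refl
  ends-with (suc zero)    = [] , refl
  ends-with (suc (suc m)) with ends-with m
  ... | y , ey = pow (S d (suc m)) (d (suc m)) ++ y ,
    trans (cong (pow (S d (suc m)) (d (suc m)) ++_) ey)
          (sym (++-assoc (pow (S d (suc m)) (d (suc m))) y (lastLetter m ∷ [])))

  W-positive : ∀ m x → S d (suc m) ≡ x ++ lastLetter (suc m) ∷ [] →
    W d (suc m) ≡ ι (lastLetter m ∷ x)
  W-positive m x ex with lastLetter-parity m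
  ... | inj₁ (ev , ℓm , ℓ1+m) rewrite ev | ex | ℓm | ℓ1+m = ι-wrap (b ∷ []) x a
  ... | inj₂ (ev , ℓm , ℓ1+m) rewrite ev | ex | ℓm | ℓ1+m = ι-wrap (a ∷ []) x b

  V-positive : ∀ m y → S d m ≡ y ++ lastLetter m ∷ [] →
    V d (suc m) ≡ ι (lastLetter (suc m) ∷ pow (S d (suc m)) (d (suc m) ∸ 1) ++ y)
  V-positive m y ey with lastLetter-parity m
  ... | inj₁ (ev , ℓm , ℓ1+m) rewrite ev | ey | ℓm | ℓ1+m = ι-wrap-prefixed a _ y b
  ... | inj₂ (ev , ℓm , ℓ1+m) rewrite ev | ey | ℓm | ℓ1+m = ι-wrap-prefixed b _ y a

  S-decomposition : ∀ m x y → 1 ≤ d (suc m) →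
    S d (suc m) ≡ x ++ lastLetter (suc m) ∷ [] → S d m ≡ y ++ lastLetter m ∷ [] →
    S d (suc (suc m)) ≡ x ++ (lastLetter (suc m) ∷ pow (S d (suc m)) (d (suc m) ∸ 1) ++ y) ++ lastLetter m ∷ []
  S-decomposition m x y d≥1 ex ey = begin
    pow s₁ (d (suc m)) ++ S d m
      ≡⟨ cong (_++ S d m) (pow-unfold s₁ (d (suc m)) d≥1) ⟩
    (s₁ ++ P) ++ S d m
      ≡⟨ cong₂ (λ p q → (p ++ P) ++ q) ex ey ⟩
    ((x ++ lastLetter (suc m) ∷ []) ++ P) ++ (y ++ lastLetter m ∷ [])
      ≡⟨ regroup x (lastLetter (suc m)) P y (lastLetter m) ⟩
    x ++ (lastLetter (suc m) ∷ P ++ y) ++ lastLetter m ∷ [] ∎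
    where
    s₁ P : Word
    s₁ = S d (suc m)
    P  = pow s₁ (d (suc m) ∸ 1)

open StandardWords

lemma6p1 : (d : ℕ → ℕ) → (∀ i → 1 ≤ i → 1 ≤ d i) →
    (n : ℕ) → 1 ≤ n →
    (ι (C (Q d (suc n) ∸ 1) (S d (suc n))) ≡ W d n · V d n)
    × (ι (C (Q d n ∸ 1) (S d (suc n))) ≡ V d n · W d n)
    × (∀ k → k + 2 ≤ Q d n →
         Σ[ u ∈ Word ] Σ[ v ∈ Word ]
           (ι (v ++ u) ≡ W d n) × (length v ≡ k + 1)
           × (ι (C k (S d (suc n))) ≡ ι u · V d n · ι v))
    × (∀ k → Q d n ≤ k + 1 → k + 1 ≤ Q d (suc n) →
         Σ[ u ∈ Word ] Σ[ v ∈ Word ]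
           (ι (v ++ u) ≡ V d n) × (length v ≡ k + 1 ∸ Q d n)
           × (ι (C k (S d (suc n))) ≡ ι u · W d n · ι v))
lemma6p1 d d≥1 (suc m) _ with ends-with d (suc m) | ends-with d m
... | x , ex | y , ey =
  ConjugateShape-transport
    (S-decomposition d m x y (d≥1 (suc m) (s≤s z≤n)) ex ey)
    (W-positive d m x ex)
    (V-positive d m y ey)
    |s₁|≡1+|x|
    (Rotations.rotations x (lastLetter (suc m) ∷ pow (S d (suc m)) (d (suc m) ∸ 1) ++ y) (lastLetter m))
  where
  |s₁|≡1+|x| : Q d (suc m) ≡ suc (length x)
  |s₁|≡1+|x| = trans (cong length ex) (trans (length-++ x) (+-comm (length x) 1))
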